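{- For all $r,q\in\mathbb{N}$ with $r>q$, $\mathrm{avg}_1(P_r) \le \mathrm{avg}_1(P_q) + (r-q)\cdot\frac{2}{3}$, where $P_n$ denotes the path on $n$ vertices.
   Context: Let $G=(V,E)$ be a finite connected graph with a fixed root $v_0$. A $1$-Lipschitz mapping of $G$ is a map $f:V\to\mathbb{Z}$ with $f(v_0)=0$ and $|f(u)-f(v)|\le 1$ for every edge $uv$; the set of these is $\mathcal{L}_1(G)$. The range of $f$ is $\mathrm{rng}(f)=|\{f(v):v\in V\}|$, and $\mathrm{avg}_1(G)=\frac{\sum_{f\in\mathcal{L}_1(G)}\mathrm{rng}(f)}{|\mathcal{L}_1(G)|}$ (independent of the choice of root). -}

module Defs where

open import Data.Nat as ℕ using (ℕ; zero; suc; _∸_; _*_; NonZero)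
open import Data.Integer as ℤ using (ℤ; +_; ∣_∣)
import Data.Integer.Properties as ℤP
open import Data.Fin using (Fin; toℕ)
open import Data.Fin.Properties using (all?)
open import Data.Vec using (Vec; []; _∷_; lookup; toList)
open import Data.List using (List; []; _∷_; map; concatMap; upTo; filter; length; deduplicate)
open import Data.Nat.ListAction using (sum)
open import Data.Product using (_×_; _,_)
open import Data.Sum using (_⊎_)
open import Data.Rational as ℚ using (ℚ; 0ℚ)
open import Relation.Nullary using (Dec; yes; no; ¬_)
open import Relation.Nullary.Decidable using (_×-dec_; _⊎-dec_; _→-dec_)
open import Relation.Binary.PropositionalEquality using (_≡_)

record RootedGraph : Set₁ where
  field
    n     : ℕ
    Adj   : Fin n → Fin n → Set
    adj?  : ∀ i j → Dec (Adj i j)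
    root  : Fin n

open RootedGraph public

Map : RootedGraph → Set
Map G = Vec ℤ (n G)

Is1Lipschitz : (G : RootedGraph) → Map G → Set
Is1Lipschitz G f =
  (lookup f (root G) ≡ + 0) ×
  (∀ u v → Adj G u v → ∣ lookup f u ℤ.- lookup f v ∣ ℕ.≤ 1)

is1Lipschitz? : (G : RootedGraph) → (f : Map G) → Dec (Is1Lipschitz G f)
is1Lipschitz? G f =
  (lookup f (root G) ℤ.≟ + 0) ×-dec
  all? (λ u → all? (λ v → adj? G u v →-dec (∣ lookup f u ℤ.- lookup f v ∣ ℕ.≤? 1)))

allVecs : (k : ℕ) → List ℤ → List (Vec ℤ k)
allVecs zero    xs = [] ∷ []
allVecs (suc k) xs = concatMap (λ x → map (x ∷_) (allVecs k xs)) xs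

-- The integers in [-(n-1), n-1].  For a connected graph on n vertices every
-- 1-Lipschitz mapping takes values in this box (distances are ≤ n-1), so this
-- enumeration is exhaustive for connected graphs.
box : ℕ → List ℤ
box m = map (λ k → + k ℤ.- + (m ∸ 1)) (upTo (2 * m ∸ 1))

L1 : (G : RootedGraph) → List (Map G)
L1 G = filter (is1Lipschitz? G) (allVecs (n G) (box (n G)))

rng : {k : ℕ} → Vec ℤ k → ℕ
rng f = length (deduplicate ℤ._≟_ (toList f))

-- a / b as a rational (b = 0 never occurs for L1, which contains the zero map).
ratio : ℕ → ℕ → ℚ
ratio a zero    = 0ℚ
ratio a (suc b) = (+ a) ℚ./ suc b

avg1 : RootedGraph → ℚ
avg1 G = ratio (sum (map rng (L1 G))) (length (L1 G))

PathAdj : {m : ℕ} → Fin m → Fin m → Set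
PathAdj i j = (toℕ j ≡ suc (toℕ i)) ⊎ (toℕ i ≡ suc (toℕ j))

P : (m : ℕ) → .{{NonZero m}} → RootedGraph
P (suc m) = record
  { n    = suc m
  ; Adj  = PathAdj
  ; adj? = λ i j → (toℕ j ℕ.≟ suc (toℕ i)) ⊎-dec (toℕ i ℕ.≟ suc (toℕ j))
  ; root = Fin.zero
  }
  where import Data.Fin as Fin

-- A 1-Lipschitz map of the path P_{k+1}, rooted at an end, is a walk 0 = f₀, f₁, …, f_k with
-- steps in {-1, 0, 1}, so there are 3^k of them.  Split a walk of length k + 1 by its first
-- step: after a step 0 the range is that of the remaining walk, after a step ±1 it grows by at
-- most one, and by translation invariance the remaining walks always have the same total range
-- S(k) as the walks from 0.  Hence S(k+1) ≤ 3 S(k) + 2·3^k, that is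
-- avg₁(P_{k+2}) ≤ avg₁(P_{k+1}) + 2/3, and the corollary follows by telescoping.
module Submission where

open import Defs
open import Data.Nat using (ℕ; suc; _<_; _∸_; NonZero)
open import Data.Integer using (+_)
open import Data.Rational using (ℚ; _≤_; _+_; _*_; _/_)

open import Data.Nat.Base as ℕ using (zero; z≤n; s≤s)
import Data.Nat.Properties as ℕ
import Data.Nat.Tactic.RingSolver as ℕ-Solver
open import Data.Nat.ListAction using (sum)
open import Data.Nat.ListAction.Properties using (sum-++)
open import Data.Integer.Base as ℤ using (ℤ; -[1+_]; ∣_∣; _⊖_; 0ℤ; 1ℤ; -1ℤ)
import Data.Integer.Properties as ℤ
import Data.Integer.Tactic.RingSolver as ℤ-Solver
import Data.Rational.Base as ℚ
import Data.Rational.Properties as ℚ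
open import Data.Rational.Unnormalised.Base as ℚᵘ using (mkℚᵘ)
import Data.Rational.Unnormalised.Properties as ℚᵘ
open import Data.Fin.Base using (toℕ) renaming (zero to fzero; suc to fsuc)
open import Data.List.Base using (List; []; _∷_; _++_; map; concatMap; filter; applyUpTo; length; deduplicate)
open import Data.List.Properties
  using (filter-++; filter-none; filter-all; filter-accept; filter-reject; filter-idem; length-filter;
         length-map; length-++; ++-identityʳ; map-++; map-∘; map-cong; map-upTo; map-concatMap;
         concatMap-map; concatMap-cong)
open import Data.List.Relation.Unary.All using (All; []; _∷_; universal)
open import Data.List.Relation.Unary.All.Properties using (map⁺; applyUpTo⁺₁; applyUpTo⁺₂)
open import Data.Vec.Base as Vec using (Vec; []; _∷_; lookup; toList)
open import Data.Vec.Properties using (toList-map)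
open import Data.Product.Base as Product using (_×_; _,_; proj₁; proj₂; ∃₂)
open import Data.Sum.Base as Sum using (inj₁; inj₂)
open import Data.Unit.Base using (⊤; tt)
open import Function.Base using (_∘_; id)
open import Function.Bundles using (_⇔_; mk⇔; Equivalence)
open import Function.Definitions using (Injective)
open import Algebra.Properties.AbelianGroup ℤ.+-0-abelianGroup using () renaming (∙-cancelˡ to +-cancelˡ)
open import Relation.Nullary using (Dec; yes; no; ¬_; ¬?)
open import Relation.Nullary.Decidable using (_×-dec_)
open import Relation.Unary using (Decidable; _⊆_; _≐_; ∁)
open import Relation.Binary.PropositionalEquality

private
  variable
    A B : Set
    k K : ℕ

filter-map : {U : B → Set} {V : A → Set} (U? : Decidable U) (V? : Decidable V) {f : A → B} →
             (U ∘ f) ≐ V → ∀ xs → filter U? (map f xs) ≡ map f (filter V? xs)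
filter-map U? V? U∘f≐V [] = refl
filter-map U? V? {f} U∘f≐V (x ∷ xs) with V? x
... | yes vx = trans (filter-accept U? (proj₂ U∘f≐V vx)) (cong (f x ∷_) (filter-map U? V? U∘f≐V xs))
... | no ¬vx = trans (filter-reject U? (¬vx ∘ proj₁ U∘f≐V)) (filter-map U? V? U∘f≐V xs)

module _ {U : A → Set} {V : A → Vec A k → Set} {W : Vec A (suc k) → Set}
         (W? : Decidable W) (U? : Decidable U) (V? : ∀ x → Decidable (V x))
         (W-∷ : ∀ {x v} → W (x ∷ v) ⇔ (U x × V x v)) where
  open Equivalence

  filter-concatMap-∷ : ∀ xs vs →
    filter W? (concatMap (λ x → map (x ∷_) vs) xs) ≡
    concatMap (λ x → map (x ∷_) (filter (V? x) vs)) (filter U? xs)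
  filter-concatMap-∷ [] vs = refl
  filter-concatMap-∷ (x ∷ xs) vs with U? x
  ... | yes ux = trans (filter-++ W? (map (x ∷_) vs) _)
    (cong₂ _++_ (filter-map W? (V? x) ((λ w → proj₂ (to W-∷ w)) , (λ v → from W-∷ (ux , v))) vs)
                (filter-concatMap-∷ xs vs))
  ... | no ¬ux = trans (filter-++ W? (map (x ∷_) vs) _)
    (cong₂ _++_ (filter-none W? (map⁺ (universal (λ v w → ¬ux (proj₁ (to W-∷ w))) vs)))
                (filter-concatMap-∷ xs vs))

dedup-map : ∀ {f : ℤ → ℤ} → Injective _≡_ _≡_ f → ∀ xs →
            deduplicate ℤ._≟_ (map f xs) ≡ map f (deduplicate ℤ._≟_ xs)
dedup-map f-inj [] = refl
dedup-map {f} f-inj (x ∷ xs) = cong (f x ∷_) (trans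
  (cong (filter (¬? ∘ (f x ℤ.≟_))) (dedup-map f-inj xs))
  (filter-map (¬? ∘ (f x ℤ.≟_)) (¬? ∘ (x ℤ.≟_)) ((_∘ cong f) , (_∘ f-inj)) (deduplicate ℤ._≟_ xs)))

applyUpTo-++ : ∀ (f : ℕ → A) m n →
               applyUpTo f (m ℕ.+ n) ≡ applyUpTo f m ++ applyUpTo (f ∘ (m ℕ.+_)) n
applyUpTo-++ f zero    n = refl
applyUpTo-++ f (suc m) n = cong (f 0 ∷_) (applyUpTo-++ (f ∘ suc) m n)

length-concatMap : ∀ (f : A → List B) xs → length (concatMap f xs) ≡ sum (map (length ∘ f) xs)
length-concatMap f []       = refl
length-concatMap f (x ∷ xs) = trans (length-++ (f x)) (cong (length (f x) ℕ.+_) (length-concatMap f xs))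

sum-map-concatMap : ∀ (g : B → ℕ) (f : A → List B) xs →
                    sum (map g (concatMap f xs)) ≡ sum (map (sum ∘ map g ∘ f) xs)
sum-map-concatMap g f []       = refl
sum-map-concatMap g f (x ∷ xs) = begin
  sum (map g (f x ++ concatMap f xs))
    ≡⟨ cong sum (map-++ g (f x) (concatMap f xs)) ⟩
  sum (map g (f x) ++ map g (concatMap f xs))
    ≡⟨ sum-++ (map g (f x)) (map g (concatMap f xs)) ⟩
  sum (map g (f x)) ℕ.+ sum (map g (concatMap f xs))
    ≡⟨ cong (sum (map g (f x)) ℕ.+_) (sum-map-concatMap g f xs) ⟩
  sum (map (sum ∘ map g ∘ f) (x ∷ xs)) ∎
  where open ≡-Reasoning

sum-map-mono : ∀ {f g : A → ℕ} → (∀ x → f x ℕ.≤ g x) →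
               ∀ xs → sum (map f xs) ℕ.≤ sum (map g xs)
sum-map-mono f≤g []       = z≤n
sum-map-mono f≤g (x ∷ xs) = ℕ.+-mono-≤ (f≤g x) (sum-map-mono f≤g xs)

sum-map-suc : ∀ (f : A → ℕ) xs → sum (map (suc ∘ f) xs) ≡ length xs ℕ.+ sum (map f xs)
sum-map-suc f []       = refl
sum-map-suc f (x ∷ xs) = cong suc (trans (cong (f x ℕ.+_) (sum-map-suc f xs)) (swap (f x) (length xs) _))
  where
  swap : ∀ l m n → l ℕ.+ (m ℕ.+ n) ≡ m ℕ.+ (l ℕ.+ n)
  swap = ℕ-Solver.solve-∀

Near : ℤ → ℤ → Set
Near a b = ∣ a ℤ.- b ∣ ℕ.≤ 1

near? : ∀ a b → Dec (Near a b)
near? a b = ∣ a ℤ.- b ∣ ℕ.≤? 1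

near-sym : ∀ {a b} → Near a b → Near b a
near-sym {a} {b} = subst (ℕ._≤ 1) (ℤ.∣i-j∣≡∣j-i∣ a b)

near-+ : ∀ a {d} → ∣ d ∣ ℕ.≤ 1 → Near a (a ℤ.+ d)
near-+ a {d} = subst (ℕ._≤ 1) (sym (trans (cong ∣_∣ (a-[a+d] a d)) (ℤ.∣-i∣≡∣i∣ d)))
  where
  a-[a+d] : ∀ a d → a ℤ.- (a ℤ.+ d) ≡ ℤ.- d
  a-[a+d] = ℤ-Solver.solve-∀

Chain : ℤ → Vec ℤ k → Set
Chain a []      = ⊤
Chain a (x ∷ v) = Near a x × Chain x v

chain? : ∀ a (v : Vec ℤ k) → Dec (Chain a v)
chain? a []      = yes tt
chain? a (x ∷ v) = near? a x ×-dec chain? x v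

steps : List ℤ
steps = -1ℤ ∷ 0ℤ ∷ 1ℤ ∷ []

neighbours : ℤ → List ℤ
neighbours a = map (ℤ._+_ a) steps

walks : ∀ k → ℤ → List (Vec ℤ k)
walks zero    a = [] ∷ []
walks (suc k) a = concatMap (λ b → map (b ∷_) (walks k b)) (neighbours a)

length-walks : ∀ k a → length (walks k a) ≡ 3 ℕ.^ k
length-walks zero    a = refl
length-walks (suc k) a = trans (length-concatMap extend (neighbours a))
  (cong sum (map-cong (λ b → trans (length-map (b ∷_) (walks k b)) (length-walks k b)) (neighbours a)))
  where
  extend : ℤ → List (Vec ℤ (suc k))
  extend b = map (b ∷_) (walks k b)

walks-+ : ∀ k t a → walks k (t ℤ.+ a) ≡ map (Vec.map (ℤ._+_ t)) (walks k a)
walks-+ zero    t a = refl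
walks-+ (suc k) t a = sym (begin
  map (Vec.map (ℤ._+_ t)) (concatMap extend (neighbours a))
    ≡⟨ map-concatMap (Vec.map (ℤ._+_ t)) extend (neighbours a) ⟩
  concatMap (map (Vec.map (ℤ._+_ t)) ∘ extend) (neighbours a)
    ≡⟨ concatMap-cong shift (neighbours a) ⟩
  concatMap (extend ∘ ℤ._+_ t) (neighbours a)
    ≡⟨ concatMap-map extend (ℤ._+_ t) (neighbours a) ⟨
  concatMap extend (map (ℤ._+_ t) (neighbours a))
    ≡⟨ cong (concatMap extend) (map-cong (λ d → sym (ℤ.+-assoc t a d)) steps) ⟩
  walks (suc k) (t ℤ.+ a) ∎)
  where
  open ≡-Reasoning
  extend : ℤ → List (Vec ℤ (suc k))
  extend b = map (b ∷_) (walks k b)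
  shift : ∀ b → map (Vec.map (ℤ._+_ t)) (extend b) ≡ extend (t ℤ.+ b)
  shift b = begin
    map (Vec.map (ℤ._+_ t)) (map (b ∷_) (walks k b))        ≡⟨ map-∘ (walks k b) ⟨
    map (λ v → (t ℤ.+ b) ∷ Vec.map (ℤ._+_ t) v) (walks k b)  ≡⟨ map-∘ (walks k b) ⟩
    map ((t ℤ.+ b) ∷_) (map (Vec.map (ℤ._+_ t)) (walks k b)) ≡⟨ cong (map _) (walks-+ k t b) ⟨
    extend (t ℤ.+ b)                                         ∎

boxPoint : ℕ → ℕ → ℤ
boxPoint K i = + i ℤ.- + K

box≡applyUpTo : ∀ K → box (suc K) ≡ applyUpTo (boxPoint K) (K ℕ.+ suc K)
box≡applyUpTo K =
  trans (map-upTo (boxPoint K) _) (cong (applyUpTo (boxPoint K) ∘ (K ℕ.+_)) (ℕ.+-identityʳ (suc K)))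

boxPoint-diff : ∀ K i j → boxPoint K j ℤ.- boxPoint K i ≡ j ⊖ i
boxPoint-diff K i j = trans (cancel (+ j) (+ i) (+ K)) (ℤ.m-n≡m⊖n j i)
  where
  cancel : ∀ x y z → (x ℤ.- z) ℤ.- (y ℤ.- z) ≡ x ℤ.- y
  cancel = ℤ-Solver.solve-∀

boxPoint-shift : ∀ K m t → boxPoint K (m ℕ.+ t) ≡ boxPoint K (suc m) ℤ.+ (t ⊖ 1)
boxPoint-shift K m t = begin
  + (m ℕ.+ t) ℤ.- + K                   ≡⟨ cong (ℤ._- + K) (ℤ.pos-+ m t) ⟩
  (+ m ℤ.+ + t) ℤ.- + K                 ≡⟨ regroup (+ m) (+ t) (+ K) 1ℤ ⟩
  boxPoint K (suc m) ℤ.+ (+ t ℤ.- 1ℤ)   ≡⟨ cong (ℤ._+_ (boxPoint K (suc m))) (ℤ.m-n≡m⊖n t 1) ⟩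
  boxPoint K (suc m) ℤ.+ (t ⊖ 1)        ∎
  where
  open ≡-Reasoning
  regroup : ∀ x y z o → (x ℤ.+ y) ℤ.- z ≡ (o ℤ.+ x ℤ.- z) ℤ.+ (y ℤ.- o)
  regroup = ℤ-Solver.solve-∀

boxPoint-apart : ∀ K {i j} → 2 ℕ.+ i ℕ.≤ j → ¬ Near (boxPoint K j) (boxPoint K i)
boxPoint-apart K {i} {j} 2+i≤j near =
  ℕ.<⇒≱ 1<∣j⊖i∣ (subst (λ x → ∣ x ∣ ℕ.≤ 1) (boxPoint-diff K i j) near)
  where
  ∣j⊖i∣≡j∸i : ∣ j ⊖ i ∣ ≡ j ∸ i
  ∣j⊖i∣≡j∸i = trans (ℤ.∣m⊖n∣≡∣n⊖m∣ j i) (ℤ.∣⊖∣-≤ (ℕ.m+n≤o⇒n≤o 2 2+i≤j))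
  1<∣j⊖i∣ : 1 ℕ.< ∣ j ⊖ i ∣
  1<∣j⊖i∣ = subst (2 ℕ.≤_) (sym ∣j⊖i∣≡j∸i) (ℕ.m+n≤o⇒m≤o∸n 2 2+i≤j)

box-index : ∀ a → ∣ a ∣ ℕ.< K →
            ∃₂ λ m r → K ℕ.+ suc K ≡ m ℕ.+ (3 ℕ.+ r) × boxPoint K (suc m) ≡ a
box-index {suc K} (+ j) (s≤s j≤K) with ℕ.m≤n⇒∃[o]m+o≡n j≤K
... | s , refl = j ℕ.+ (j ℕ.+ s) , s , size j s ,
  trans (ℤ.⊖-≥ (s≤s (ℕ.m≤n+m (j ℕ.+ s) j))) (cong +_ (ℕ.m+n∸n≡m j (j ℕ.+ s)))
  where
  size : ∀ j s → suc (j ℕ.+ s) ℕ.+ suc (suc (j ℕ.+ s)) ≡ j ℕ.+ (j ℕ.+ s) ℕ.+ (3 ℕ.+ s)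
  size = ℕ-Solver.solve-∀
box-index {suc K} -[1+ j ] (s≤s j<K) with ℕ.m≤n⇒∃[o]m+o≡n j<K
... | s , refl = s , suc (suc (j ℕ.+ (j ℕ.+ s))) , size j s ,
  trans (ℤ.⊖-< (s≤s (ℕ.m<n+m s ℕ.z<s))) (cong (ℤ.-_ ∘ +_) (ℕ.m+n∸n≡m (suc j) s))
  where
  size : ∀ j s → suc (suc j ℕ.+ s) ℕ.+ suc (suc (suc j ℕ.+ s)) ≡
                 s ℕ.+ (3 ℕ.+ suc (suc (j ℕ.+ (j ℕ.+ s))))
  size = ℕ-Solver.solve-∀

-- The box lists -K, …, K in increasing order; around an interior point a it reads
-- below ++ neighbours a ++ above, and every point of below and above is at distance ≥ 2 from a.
filter-box : ∀ a {U : ℤ → Set} (U? : Decidable U) → U ⊆ Near a → ∣ a ∣ ℕ.< K →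
             filter U? (box (suc K)) ≡ filter U? (neighbours a)
filter-box {K} a {U} U? U⊆Near a<K with box-index a a<K
... | m , r , size , refl = begin
  filter U? (box (suc K))
    ≡⟨ cong (filter U?) (trans (box≡applyUpTo K) (trans (cong (applyUpTo f) size) (applyUpTo-++ f m _))) ⟩
  filter U? (below ++ f (m ℕ.+ 0) ∷ f (m ℕ.+ 1) ∷ f (m ℕ.+ 2) ∷ above)
    ≡⟨ cong (λ w → filter U? (below ++ w ++ above)) window ⟩
  filter U? (below ++ neighbours a ++ above)
    ≡⟨ filter-++ U? below (neighbours a ++ above) ⟩
  filter U? below ++ filter U? (neighbours a ++ above)
    ≡⟨ cong₂ _++_ (filter-none U? (applyUpTo⁺₁ f m far-below)) (filter-++ U? (neighbours a) above) ⟩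
  filter U? (neighbours a) ++ filter U? above
    ≡⟨ cong (filter U? (neighbours a) ++_) (filter-none U? (applyUpTo⁺₂ _ r far-above)) ⟩
  filter U? (neighbours a) ++ []
    ≡⟨ ++-identityʳ (filter U? (neighbours a)) ⟩
  filter U? (neighbours a) ∎
  where
  open ≡-Reasoning
  f : ℕ → ℤ
  f = boxPoint K
  below above : List ℤ
  below = applyUpTo f m
  above = applyUpTo (f ∘ (m ℕ.+_) ∘ (3 ℕ.+_)) r
  window : f (m ℕ.+ 0) ∷ f (m ℕ.+ 1) ∷ f (m ℕ.+ 2) ∷ [] ≡ neighbours a
  window = cong₂ _∷_ (boxPoint-shift K m 0)
             (cong₂ _∷_ (boxPoint-shift K m 1) (cong₂ _∷_ (boxPoint-shift K m 2) refl))
  far-below : ∀ {i} → i ℕ.< m → ∁ U (f i)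
  far-below i<m = boxPoint-apart K (s≤s i<m) ∘ U⊆Near
  far-above : ∀ t → ∁ U (f (m ℕ.+ (3 ℕ.+ t)))
  far-above t = boxPoint-apart K 3+m≤m+[3+t] ∘ near-sym {a} ∘ U⊆Near
    where
    3+m≤m+[3+t] : 3 ℕ.+ m ℕ.≤ m ℕ.+ (3 ℕ.+ t)
    3+m≤m+[3+t] = ℕ.≤-trans (ℕ.≤-reflexive (ℕ.+-comm 3 m)) (ℕ.+-monoʳ-≤ m (ℕ.m≤m+n 3 t))

filter-box-root : ∀ K → filter (ℤ._≟ 0ℤ) (box (suc K)) ≡ 0ℤ ∷ []
filter-box-root zero    = refl
filter-box-root (suc K) = filter-box {suc K} 0ℤ (ℤ._≟ 0ℤ) (λ { refl → z≤n }) (s≤s z≤n)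

neighbour-bound : ∀ a {d} → ∣ d ∣ ℕ.≤ 1 →
                  ∣ a ∣ ℕ.+ suc k ℕ.≤ K → ∣ a ℤ.+ d ∣ ℕ.+ k ℕ.≤ K
neighbour-bound {k} {K} a {d} ∣d∣≤1 bound = begin
  ∣ a ℤ.+ d ∣ ℕ.+ k     ≤⟨ ℕ.+-monoˡ-≤ k (ℤ.∣i+j∣≤∣i∣+∣j∣ a d) ⟩
  ∣ a ∣ ℕ.+ ∣ d ∣ ℕ.+ k ≤⟨ ℕ.+-monoˡ-≤ k (ℕ.+-monoʳ-≤ ∣ a ∣ ∣d∣≤1) ⟩
  ∣ a ∣ ℕ.+ 1 ℕ.+ k     ≡⟨ ℕ.+-assoc ∣ a ∣ 1 k ⟩
  ∣ a ∣ ℕ.+ suc k       ≤⟨ bound ⟩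
  K                     ∎
  where open ℕ.≤-Reasoning

filter-chain : ∀ a → ∣ a ∣ ℕ.+ k ℕ.≤ K → filter (chain? a) (allVecs k (box (suc K))) ≡ walks k a
filter-chain {zero}      a _     = refl
filter-chain {suc k} {K} a bound = begin
  filter (chain? a) (allVecs (suc k) grid)
    ≡⟨ filter-concatMap-∷ (chain? a) (near? a) chain? (mk⇔ id id) grid (allVecs k grid) ⟩
  concatMap extend (filter (near? a) grid)
    ≡⟨ cong (concatMap extend) (trans (filter-box a (near? a) id a<K) (filter-all (near? a) all-near)) ⟩
  concatMap extend (neighbours a)
    ≡⟨ cong₂ _++_ (branch (s≤s z≤n)) (cong₂ _++_ (branch z≤n) (cong₂ _++_ (branch (s≤s z≤n)) refl)) ⟩
  walks (suc k) a ∎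
  where
  open ≡-Reasoning
  grid : List ℤ
  grid = box (suc K)
  extend : ℤ → List (Vec ℤ (suc k))
  extend x = map (x ∷_) (filter (chain? x) (allVecs k grid))
  a<K : ∣ a ∣ ℕ.< K
  a<K = ℕ.<-≤-trans (ℕ.m<m+n ∣ a ∣ ℕ.z<s) bound
  all-near : All (Near a) (neighbours a)
  all-near = near-+ a (s≤s z≤n) ∷ near-+ a z≤n ∷ near-+ a (s≤s z≤n) ∷ []
  branch : ∀ {d} → ∣ d ∣ ℕ.≤ 1 → extend (a ℤ.+ d) ≡ map ((a ℤ.+ d) ∷_) (walks k (a ℤ.+ d))
  branch {d} ∣d∣≤1 = cong (map _) (filter-chain (a ℤ.+ d) (neighbour-bound a ∣d∣≤1 bound))

PathLipschitz : Vec ℤ k → Set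
PathLipschitz f = ∀ u w → PathAdj u w → Near (lookup f u) (lookup f w)

chain⇒near-next : ∀ {x} {v : Vec ℤ k} → Chain x v → ∀ u w → toℕ w ≡ suc (toℕ u) →
                  Near (lookup (x ∷ v) u) (lookup (x ∷ v) w)
chain⇒near-next {v = []}    _           fzero    fzero           ()
chain⇒near-next {v = _ ∷ _} _           fzero    fzero           ()
chain⇒near-next {v = _ ∷ _} (x~y , _)   fzero    (fsuc fzero)    _  = x~y
chain⇒near-next {v = _ ∷ _} _           fzero    (fsuc (fsuc _)) ()
chain⇒near-next {v = _ ∷ _} _           (fsuc _) fzero           ()
chain⇒near-next {v = _ ∷ _} (_ , chain) (fsuc u) (fsuc w)        eq =
  chain⇒near-next chain u w (ℕ.suc-injective eq)

chain⇔pathLipschitz : ∀ {x} {v : Vec ℤ k} → Chain x v ⇔ PathLipschitz (x ∷ v)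
chain⇔pathLipschitz = mk⇔ chain⇒lipschitz lipschitz⇒chain
  where
  chain⇒lipschitz : ∀ {k x} {v : Vec ℤ k} → Chain x v → PathLipschitz (x ∷ v)
  chain⇒lipschitz chain u w (inj₁ w≡1+u) = chain⇒near-next chain u w w≡1+u
  chain⇒lipschitz {x = x} {v} chain u w (inj₂ u≡1+w) =
    near-sym {lookup (x ∷ v) w} (chain⇒near-next chain w u u≡1+w)
  lipschitz⇒chain : ∀ {k x} {v : Vec ℤ k} → PathLipschitz (x ∷ v) → Chain x v
  lipschitz⇒chain {v = []}    _   = tt
  lipschitz⇒chain {v = _ ∷ _} lip =
    lip fzero (fsuc fzero) (inj₁ refl) ,
    lipschitz⇒chain (λ u w → lip (fsuc u) (fsuc w) ∘ Sum.map (cong suc) (cong suc))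

L1-path : ∀ k → L1 (P (suc k)) ≡ map (0ℤ ∷_) (walks k 0ℤ)
L1-path k = begin
  filter (is1Lipschitz? (P (suc k))) (allVecs (suc k) grid)
    ≡⟨ filter-concatMap-∷ (is1Lipschitz? (P (suc k))) (ℤ._≟ 0ℤ) chain? rooted-chain
                          grid (allVecs k grid) ⟩
  concatMap (λ x → map (x ∷_) (filter (chain? x) (allVecs k grid))) (filter (ℤ._≟ 0ℤ) grid)
    ≡⟨ cong (concatMap _) (filter-box-root k) ⟩
  map (0ℤ ∷_) (filter (chain? 0ℤ) (allVecs k grid)) ++ []
    ≡⟨ ++-identityʳ _ ⟩
  map (0ℤ ∷_) (filter (chain? 0ℤ) (allVecs k grid))
    ≡⟨ cong (map (0ℤ ∷_)) (filter-chain 0ℤ ℕ.≤-refl) ⟩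
  map (0ℤ ∷_) (walks k 0ℤ) ∎
  where
  open ≡-Reasoning
  grid : List ℤ
  grid = box (suc k)
  rooted-chain : ∀ {x} {v : Vec ℤ k} → Is1Lipschitz (P (suc k)) (x ∷ v) ⇔ (x ≡ 0ℤ × Chain x v)
  rooted-chain = mk⇔ (Product.map₂ (Equivalence.from chain⇔pathLipschitz))
                     (Product.map₂ (Equivalence.to chain⇔pathLipschitz))

rng-map : ∀ {f : ℤ → ℤ} → Injective _≡_ _≡_ f → (v : Vec ℤ k) → rng (Vec.map f v) ≡ rng v
rng-map {f = f} f-inj v = begin
  length (deduplicate ℤ._≟_ (toList (Vec.map f v)))
    ≡⟨ cong (length ∘ deduplicate ℤ._≟_) (toList-map f v) ⟩
  length (deduplicate ℤ._≟_ (map f (toList v)))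
    ≡⟨ cong length (dedup-map f-inj (toList v)) ⟩
  length (map f (deduplicate ℤ._≟_ (toList v)))
    ≡⟨ length-map f (deduplicate ℤ._≟_ (toList v)) ⟩
  rng v ∎
  where open ≡-Reasoning

rng-∷-≤ : ∀ x (v : Vec ℤ k) → rng (x ∷ v) ℕ.≤ suc (rng v)
rng-∷-≤ x v = s≤s (length-filter (¬? ∘ (x ℤ.≟_)) (deduplicate ℤ._≟_ (toList v)))

rng-∷-∷ : ∀ x (v : Vec ℤ k) → rng (x ∷ x ∷ v) ≡ rng (x ∷ v)
rng-∷-∷ x v = cong (suc ∘ length)
  (trans (filter-reject (¬? ∘ (x ℤ.≟_)) (λ x≢x → x≢x refl)) (filter-idem (¬? ∘ (x ℤ.≟_)) rest))
  where
  rest : List ℤ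
  rest = deduplicate ℤ._≟_ (toList v)

rangeSum : ℕ → ℤ → ℕ
rangeSum k a = sum (map (λ v → rng (a ∷ v)) (walks k a))

rangeSum-+ : ∀ k t a → rangeSum k (t ℤ.+ a) ≡ rangeSum k a
rangeSum-+ k t a = begin
  sum (map (λ v → rng ((t ℤ.+ a) ∷ v)) (walks k (t ℤ.+ a)))
    ≡⟨ cong (sum ∘ map _) (walks-+ k t a) ⟩
  sum (map (λ v → rng ((t ℤ.+ a) ∷ v)) (map (Vec.map (ℤ._+_ t)) (walks k a)))
    ≡⟨ cong sum (map-∘ (walks k a)) ⟨
  sum (map (λ v → rng (Vec.map (ℤ._+_ t) (a ∷ v))) (walks k a))
    ≡⟨ cong sum (map-cong (λ v → rng-map (+-cancelˡ t _ _) (a ∷ v)) (walks k a)) ⟩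
  rangeSum k a ∎
  where open ≡-Reasoning

rangeSum-translate : ∀ k a → rangeSum k a ≡ rangeSum k 0ℤ
rangeSum-translate k a = trans (cong (rangeSum k) (sym (ℤ.+-identityʳ a))) (rangeSum-+ k a 0ℤ)

rangeSum-∷-≤ : ∀ k c b →
               sum (map (λ v → rng (c ∷ b ∷ v)) (walks k b)) ℕ.≤ 3 ℕ.^ k ℕ.+ rangeSum k 0ℤ
rangeSum-∷-≤ k c b = begin
  sum (map (λ v → rng (c ∷ b ∷ v)) (walks k b))
    ≤⟨ sum-map-mono (λ v → rng-∷-≤ c (b ∷ v)) (walks k b) ⟩
  sum (map (λ v → suc (rng (b ∷ v))) (walks k b))
    ≡⟨ sum-map-suc (λ v → rng (b ∷ v)) (walks k b) ⟩
  length (walks k b) ℕ.+ rangeSum k b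
    ≡⟨ cong₂ ℕ._+_ (length-walks k b) (rangeSum-translate k b) ⟩
  3 ℕ.^ k ℕ.+ rangeSum k 0ℤ ∎
  where open ℕ.≤-Reasoning

rangeSum-suc : ∀ k → rangeSum (suc k) 0ℤ ℕ.≤ 3 ℕ.* rangeSum k 0ℤ ℕ.+ 2 ℕ.* 3 ℕ.^ k
rangeSum-suc k = begin
  rangeSum (suc k) 0ℤ
    ≡⟨ sum-map-concatMap (λ v → rng (0ℤ ∷ v)) extend (neighbours 0ℤ) ⟩
  branch -1ℤ ℕ.+ (branch 0ℤ ℕ.+ (branch 1ℤ ℕ.+ 0))
    ≤⟨ ℕ.+-mono-≤ (move-≤ -1ℤ) (ℕ.+-mono-≤ (ℕ.≤-reflexive stay) (ℕ.+-monoˡ-≤ 0 (move-≤ 1ℤ))) ⟩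
  (3 ℕ.^ k ℕ.+ T) ℕ.+ (T ℕ.+ ((3 ℕ.^ k ℕ.+ T) ℕ.+ 0))
    ≡⟨ collect (3 ℕ.^ k) T ⟩
  3 ℕ.* T ℕ.+ 2 ℕ.* 3 ℕ.^ k ∎
  where
  open ℕ.≤-Reasoning
  T : ℕ
  T = rangeSum k 0ℤ
  extend : ℤ → List (Vec ℤ (suc k))
  extend b = map (b ∷_) (walks k b)
  branch : ℤ → ℕ
  branch b = sum (map (λ v → rng (0ℤ ∷ v)) (extend b))
  move-≤ : ∀ b → branch b ℕ.≤ 3 ℕ.^ k ℕ.+ T
  move-≤ b = ℕ.≤-trans (ℕ.≤-reflexive (cong sum (sym (map-∘ (walks k b))))) (rangeSum-∷-≤ k 0ℤ b)
  stay : branch 0ℤ ≡ T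
  stay = trans (cong sum (sym (map-∘ (walks k 0ℤ)))) (cong sum (map-cong (rng-∷-∷ 0ℤ) (walks k 0ℤ)))
  collect : ∀ n t → (n ℕ.+ t) ℕ.+ (t ℕ.+ ((n ℕ.+ t) ℕ.+ 0)) ≡ 3 ℕ.* t ℕ.+ 2 ℕ.* n
  collect = ℕ-Solver.solve-∀

avg1-path : ∀ k → avg1 (P (suc k)) ≡ ratio (rangeSum k 0ℤ) (3 ℕ.^ k)
avg1-path k = cong₂ ratio
  (trans (cong (sum ∘ map rng) (L1-path k)) (cong sum (sym (map-∘ (walks k 0ℤ)))))
  (trans (cong length (L1-path k)) (trans (length-map (0ℤ ∷_) (walks k 0ℤ)) (length-walks k 0ℤ)))

toℚᵘ-ratio : ∀ a n → ℚ.toℚᵘ (ratio a (suc n)) ℚᵘ.≃ mkℚᵘ (+ a) n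
toℚᵘ-ratio a n = ℚ.toℚᵘ-fromℚᵘ (mkℚᵘ (+ a) n)

ratio-step : ∀ a b d .{{_ : NonZero d}} → a ℕ.≤ 3 ℕ.* b ℕ.+ 2 ℕ.* d →
             ratio a (3 ℕ.* d) ≤ ratio b d + (+ 2) / 3
ratio-step a b d@(suc n) a≤ = ℚ.toℚᵘ-cancel-≤ (begin
  ℚ.toℚᵘ (ratio a (3 ℕ.* d))                 ≃⟨ toℚᵘ-ratio a _ ⟩
  mkℚᵘ (+ a) _                               ≤⟨ ℚᵘ.*≤* cross ⟩
  mkℚᵘ (+ b) n ℚᵘ.+ mkℚᵘ (+ 2) 2             ≃⟨ ℚᵘ.+-congˡ _ (toℚᵘ-ratio b n) ⟨
  ℚ.toℚᵘ (ratio b d) ℚᵘ.+ ℚ.toℚᵘ ((+ 2) / 3) ≃⟨ ℚ.toℚᵘ-homo-+ (ratio b d) ((+ 2) / 3) ⟨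
  ℚ.toℚᵘ (ratio b d + (+ 2) / 3)             ∎)
  where
  open ℚᵘ.≤-Reasoning
  regroup : ∀ b d → (3 ℕ.* b ℕ.+ 2 ℕ.* d) ℕ.* (d ℕ.* 3) ≡ (b ℕ.* 3 ℕ.+ 2 ℕ.* d) ℕ.* (3 ℕ.* d)
  regroup = ℕ-Solver.solve-∀
  cross-ℕ : a ℕ.* (d ℕ.* 3) ℕ.≤ (b ℕ.* 3 ℕ.+ 2 ℕ.* d) ℕ.* (3 ℕ.* d)
  cross-ℕ = ℕ.≤-trans (ℕ.*-monoˡ-≤ (d ℕ.* 3) a≤) (ℕ.≤-reflexive (regroup b d))
  cross : + a ℤ.* + (d ℕ.* 3) ℤ.≤ (+ b ℤ.* + 3 ℤ.+ + 2 ℤ.* + d) ℤ.* + (3 ℕ.* d)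
  cross = subst₂ ℤ._≤_ (ℤ.pos-* a (d ℕ.* 3))
    (trans (ℤ.pos-* (b ℕ.* 3 ℕ.+ 2 ℕ.* d) (3 ℕ.* d)) (cong (ℤ._* + (3 ℕ.* d))
      (trans (ℤ.pos-+ (b ℕ.* 3) (2 ℕ.* d)) (cong₂ ℤ._+_ (ℤ.pos-* b 3) (ℤ.pos-* 2 d)))))
    (ℤ.+≤+ cross-ℕ)

avg1-path-suc : ∀ k → avg1 (P (suc (suc k))) ≤ avg1 (P (suc k)) + (+ 2) / 3
avg1-path-suc k = subst₂ _≤_ (sym (avg1-path (suc k))) (cong (_+ (+ 2) / 3) (sym (avg1-path k)))
  (ratio-step _ _ (3 ℕ.^ k) {{ℕ.m^n≢0 3 k}} (rangeSum-suc k))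

[1+j]/1≡j/1+1 : ∀ j → (+ suc j) / 1 ≡ (+ j) / 1 + ℚ.1ℚ
[1+j]/1≡j/1+1 j = ℚ.toℚᵘ-injective (begin-equality
  ℚ.toℚᵘ ((+ suc j) / 1)              ≃⟨ toℚᵘ-ratio (suc j) 0 ⟩
  mkℚᵘ (+ suc j) 0                    ≃⟨ ℚᵘ.*≡* (split (+ j)) ⟩
  mkℚᵘ (+ j) 0 ℚᵘ.+ mkℚᵘ (+ 1) 0      ≃⟨ ℚᵘ.+-congˡ _ (toℚᵘ-ratio j 0) ⟨
  ℚ.toℚᵘ ((+ j) / 1) ℚᵘ.+ ℚ.toℚᵘ ℚ.1ℚ ≃⟨ ℚ.toℚᵘ-homo-+ ((+ j) / 1) ℚ.1ℚ ⟨
  ℚ.toℚᵘ ((+ j) / 1 + ℚ.1ℚ)           ∎)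
  where
  open ℚᵘ.≤-Reasoning
  split : ∀ x → (1ℤ ℤ.+ x) ℤ.* 1ℤ ≡ (x ℤ.* 1ℤ ℤ.+ 1ℤ ℤ.* 1ℤ) ℤ.* 1ℤ
  split = ℤ-Solver.solve-∀

telescope : ∀ (x : ℕ → ℚ) c → (∀ k → x (suc k) ≤ x k + c) →
            ∀ q j → x (j ℕ.+ q) ≤ x q + (+ j) / 1 * c
telescope x c step q zero =
  ℚ.≤-reflexive (sym (trans (cong (_+_ (x q)) (ℚ.*-zeroˡ c)) (ℚ.+-identityʳ (x q))))
telescope x c step q (suc j) = begin
  x (suc j ℕ.+ q)                  ≤⟨ step (j ℕ.+ q) ⟩
  x (j ℕ.+ q) + c                  ≤⟨ ℚ.+-monoˡ-≤ c (telescope x c step q j) ⟩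
  x q + (+ j) / 1 * c + c          ≡⟨ ℚ.+-assoc (x q) ((+ j) / 1 * c) c ⟩
  x q + ((+ j) / 1 * c + c)        ≡⟨ cong (_+_ (x q)) (cong (_+_ ((+ j) / 1 * c)) (ℚ.*-identityˡ c)) ⟨
  x q + ((+ j) / 1 * c + ℚ.1ℚ * c) ≡⟨ cong (_+_ (x q)) (ℚ.*-distribʳ-+ c ((+ j) / 1) ℚ.1ℚ) ⟨
  x q + ((+ j) / 1 + ℚ.1ℚ) * c     ≡⟨ cong (λ y → x q + y * c) ([1+j]/1≡j/1+1 j) ⟨
  x q + (+ suc j) / 1 * c          ∎
  where open ℚ.≤-Reasoning

corollary2 : (r q : ℕ) → .{{_ : NonZero q}} → .{{_ : NonZero r}} → q < r →
    avg1 (P r) ≤ avg1 (P q) + (+ (r ∸ q)) / 1 * ((+ 2) / 3)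
corollary2 (suc r) (suc q) (s≤s q<r) =
  subst (λ n → avg1 (P (suc n)) ≤ avg1 (P (suc q)) + (+ (r ∸ q)) / 1 * ((+ 2) / 3))
    (ℕ.m∸n+n≡m (ℕ.<⇒≤ q<r))
    (telescope (λ k → avg1 (P (suc k))) ((+ 2) / 3) avg1-path-suc q (r ∸ q))
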